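{- For every io-disjoint FLIF expression $\alpha$ over a database schema $\mathcal{S}$ there exists a plan $E_\alpha$ over $\mathcal{S}$ with input variables $I(\alpha)$ such that $\mathrm{Eval}_\alpha(D,N) = E_\alpha(D,N)$ for every instance $D$ of $\mathcal{S}$ and every set $N$ of valuations on $I(\alpha)$. Here $\mathrm{Eval}_\alpha(D,N)=\bigcup_{\nu_{\rm in}\in N}\mathrm{Eval}_\alpha(D,\nu_{\rm in})$, where $\mathrm{Eval}_\alpha(D,\nu_{\rm in}) = \{\nu_{\rm out}|_{\mathit{vars}(\alpha)} \mid \exists \nu_{\rm in}' : \nu_{\rm in} \subseteq \nu_{\rm in}' \text{ and } (\nu_{\rm in}',\nu_{\rm out}) \in [\![\alpha]\!]_D\}$.
   Context: FLIF expressions over a schema $\mathcal{S}$ (relation names with arities and input arities; atoms $R(\bar x;\bar y)$ with $\bar x$ the input positions) are built from atomic expressions $R(\bar x;\bar y)$, $(x=y)$, $(x=c)$, $(x:=y)$, $(x:=c)$ using composition $;$, union $\cup$ and difference $-$. Their semantics $[\![\alpha]\!]_D$ on an instance $D$ is a set of pairs of valuations: $R(\bar x;\bar y)$ gives pairs $(\nu_1,\nu_2)$ with $\nu_1(\bar x)\cdot\nu_2(\bar y)\in D(R)$ and $\nu_1,\nu_2$ agreeing outside $\bar y$; equality tests give identical pairs satisfying the test; assignments update one variable; composition is relational composition, union and difference are set operations. $\mathit{vars}(\alpha)$ is the set of variables in $\alpha$. Input/output variables: $I(R(\bar x;\bar y))=X$, $O=Y$ (variable sets of $\bar x,\bar y$);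 $I(x=y)=\{x,y\}$, $O=\emptyset$; $I(x:=y)=\{y\}$, $O=\{x\}$; $I(x=c)=\{x\}$, $O=\emptyset$; $I(x:=c)=\emptyset$, $O=\{x\}$; $I(\alpha_1;\alpha_2)=I(\alpha_1)\cup(I(\alpha_2)\setminus O(\alpha_1))$, $O=O(\alpha_1)\cup O(\alpha_2)$; $I(\alpha_1\cup\alpha_2)=I(\alpha_1-\alpha_2)=I(\alpha_1)\cup I(\alpha_2)\cup(O(\alpha_1)\mathbin{\triangle}O(\alpha_2))$, with $O(\alpha_1\cup\alpha_2)=O(\alpha_1)\cup O(\alpha_2)$ and $O(\alpha_1-\alpha_2)=O(\alpha_1)$. An expression is io-disjoint if $I(\beta)\cap O(\beta)=\emptyset$ for every subexpression $\beta$ (including itself). Plans (named relational algebra; valuations on a variable set viewed as tuples over that schema): for a finite set $I$, a plan over $\mathcal{S}$ with input variables $I$ is built as follows: the relation name $\mathit{In}$ with schema $I$ is a plan; if $E$ is a plan with output schema $Z$ and $R(\bar x;\bar y)$ is an atomic io-disjoint expression with $X\subseteq Z$ and $Z\cap Y=\emptyset$, then $E \overset{\rm access}{\bowtie} R(\bar x;\bar y)$ is a plan with schema $Z\cup Y$, whose value is $\{\nu \text{ on } Z\cup Y \mid \nu|_Z\in E,\ \nu(\bar x)\cdot\nu(\bar y)\in D(R)\}$; plans are closed under union, difference (same schemas), natural join, projection, selection, and generalized projection $\pi_{Z,x:=y}$, $\pi_{Z,x:=c}$ (adding a new attribute $x$ equal to $y$ or to constant $c$). $E(D,N)$ is the result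 of evaluating $E$ on $D$ with $\mathit{In}$ instantiated by $N$. -}

module Defs where

open import Data.Nat using (ℕ; _≟_)
open import Data.List using (List; []; _∷_; _++_; filter)
open import Data.List.Membership.Propositional using (_∈_; _∉_)
open import Data.List.Membership.DecPropositional _≟_ using (_∈?_)
open import Data.Vec using (Vec)
import Data.Vec as Vec
open import Data.Product using (Σ; ∃; _×_; _,_)
open import Data.Sum using (_⊎_)
open import Data.Empty using (⊥)
open import Relation.Nullary using (¬_)
open import Relation.Nullary.Decidable using (¬?)
open import Relation.Binary.PropositionalEquality using (_≡_)
open import Function.Bundles using (_⇔_)

Var : Set
Var = ℕ

Dom : Set
Dom = ℕ

-- Finite sets of variables are represented by lists (order/duplicates
-- irrelevant; all notions below only use membership).
VarSet : Set
VarSet = List Var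

_⊆_ : VarSet → VarSet → Set
A ⊆ B = ∀ {z} → z ∈ A → z ∈ B

_≈ₛ_ : VarSet → VarSet → Set
A ≈ₛ B = (A ⊆ B) × (B ⊆ A)

Disjoint : VarSet → VarSet → Set
Disjoint A B = ∀ {z} → z ∈ A → z ∈ B → ⊥

_∖_ : VarSet → VarSet → VarSet
A ∖ B = filter (λ z → ¬? (z ∈? B)) A

_△_ : VarSet → VarSet → VarSet
A △ B = (A ∖ B) ++ (B ∖ A)

-- Valuations.  A valuation on a finite set Z of variables is represented
-- by a total valuation Var → Dom, considered only up to its restriction
-- to Z; "ν and μ agree on Z" is ν ≈[ Z ] μ.

Val : Set
Val = Var → Dom

_≈[_]_ : Val → VarSet → Val → Set
ν ≈[ Z ] μ = ∀ {z} → z ∈ Z → ν z ≡ μ z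

record Schema : Set₁ where
  field
    Rel       : Set
    inArity   : Rel → ℕ
    outArity  : Rel → ℕ

open Schema public

Tuple : (S : Schema) → Rel S → Set
Tuple S R = Vec Dom (inArity S R Data.Nat.+ outArity S R)

Instance : Schema → Set
Instance S = (R : Rel S) → List (Tuple S R)

module _ (S : Schema) where

  data Expr : Set where
    atom   : (R : Rel S) → Vec Var (inArity S R) → Vec Var (outArity S R) → Expr
    eqv    : Var → Var → Expr
    eqc    : Var → Dom → Expr
    asv    : Var → Var → Expr
    asc    : Var → Dom → Expr
    _⨾_    : Expr → Expr → Expr
    _∪ₑ_   : Expr → Expr → Expr
    _−ₑ_   : Expr → Expr → Expr

module _ {S : Schema} where

  vars : Expr S → VarSet
  vars (atom R xs ys) = Vec.toList xs ++ Vec.toList ys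
  vars (eqv x y) = x ∷ y ∷ []
  vars (eqc x c) = x ∷ []
  vars (asv x y) = x ∷ y ∷ []
  vars (asc x c) = x ∷ []
  vars (a ⨾ b) = vars a ++ vars b
  vars (a ∪ₑ b) = vars a ++ vars b
  vars (a −ₑ b) = vars a ++ vars b

  O : Expr S → VarSet
  O (atom R xs ys) = Vec.toList ys
  O (eqv x y) = []
  O (eqc x c) = []
  O (asv x y) = x ∷ []
  O (asc x c) = x ∷ []
  O (a ⨾ b) = O a ++ O b
  O (a ∪ₑ b) = O a ++ O b
  O (a −ₑ b) = O a

  I : Expr S → VarSet
  I (atom R xs ys) = Vec.toList xs
  I (eqv x y) = x ∷ y ∷ []
  I (eqc x c) = x ∷ []
  I (asv x y) = y ∷ []
  I (asc x c) = []
  I (a ⨾ b) = I a ++ (I b ∖ O a)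
  I (a ∪ₑ b) = I a ++ I b ++ (O a △ O b)
  I (a −ₑ b) = I a ++ I b ++ (O a △ O b)

  IODisjoint : Expr S → Set
  IODisjoint a@(atom R xs ys) = Disjoint (I a) (O a)
  IODisjoint a@(eqv x y) = Disjoint (I a) (O a)
  IODisjoint a@(eqc x c) = Disjoint (I a) (O a)
  IODisjoint a@(asv x y) = Disjoint (I a) (O a)
  IODisjoint a@(asc x c) = Disjoint (I a) (O a)
  IODisjoint (a ⨾ b) = Disjoint (I (a ⨾ b)) (O (a ⨾ b)) × IODisjoint a × IODisjoint b
  IODisjoint (a ∪ₑ b) = Disjoint (I (a ∪ₑ b)) (O (a ∪ₑ b)) × IODisjoint a × IODisjoint b
  IODisjoint (a −ₑ b) = Disjoint (I (a −ₑ b)) (O (a −ₑ b)) × IODisjoint a × IODisjoint b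

  -- semantics ⟦ α ⟧_D as a binary relation on valuations
  -- (identity of valuations is pointwise equality)
  ⟦_⟧ₑ : Expr S → Instance S → Val → Val → Set
  ⟦ atom R xs ys ⟧ₑ D ν₁ ν₂ =
    ((Vec.map ν₁ xs Vec.++ Vec.map ν₂ ys) ∈ D R)
    × (∀ z → z ∉ Vec.toList ys → ν₁ z ≡ ν₂ z)
  ⟦ eqv x y ⟧ₑ D ν₁ ν₂ = (∀ z → ν₁ z ≡ ν₂ z) × ν₁ x ≡ ν₁ y
  ⟦ eqc x c ⟧ₑ D ν₁ ν₂ = (∀ z → ν₁ z ≡ ν₂ z) × ν₁ x ≡ c
  ⟦ asv x y ⟧ₑ D ν₁ ν₂ = ν₂ x ≡ ν₁ y × (∀ z → ¬ z ≡ x → ν₁ z ≡ ν₂ z)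
  ⟦ asc x c ⟧ₑ D ν₁ ν₂ = ν₂ x ≡ c × (∀ z → ¬ z ≡ x → ν₁ z ≡ ν₂ z)
  ⟦ a ⨾ b ⟧ₑ D ν₁ ν₂ = ∃ λ ν → ⟦ a ⟧ₑ D ν₁ ν × ⟦ b ⟧ₑ D ν ν₂
  ⟦ a ∪ₑ b ⟧ₑ D ν₁ ν₂ = ⟦ a ⟧ₑ D ν₁ ν₂ ⊎ ⟦ b ⟧ₑ D ν₁ ν₂
  ⟦ a −ₑ b ⟧ₑ D ν₁ ν₂ = ⟦ a ⟧ₑ D ν₁ ν₂ × ¬ ⟦ b ⟧ₑ D ν₁ ν₂

  -- N is a set of valuations on
  -- I(α) (a predicate on total valuations, read via restriction to I(α));
  -- the result is a set of valuations on vars(α), given as the predicate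
  -- "ν restricted to vars(α) belongs to the set".
  Eval : (α : Expr S) → Instance S → (Val → Set) → Val → Set
  Eval α D N ν = ∃ λ νin → N νin × ∃ λ νin' → (νin ≈[ I α ] νin') ×
                   ∃ λ νout → ⟦ α ⟧ₑ D νin' νout × (νout ≈[ vars α ] ν)

-- Plans over S with input variables In, indexed by their output schema.

module _ (S : Schema) (In : VarSet) where

  data Plan : VarSet → Set where
    inp    : Plan In
    access : ∀ {Z} → Plan Z → (R : Rel S) (xs : Vec Var (inArity S R)) (ys : Vec Var (outArity S R))
           → Disjoint (Vec.toList xs) (Vec.toList ys)
           → Vec.toList xs ⊆ Z → Disjoint Z (Vec.toList ys)
           → Plan (Z ++ Vec.toList ys)
    union  : ∀ {Z₁ Z₂} → Plan Z₁ → Plan Z₂ → Z₁ ≈ₛ Z₂ → Plan Z₁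
    diff   : ∀ {Z₁ Z₂} → Plan Z₁ → Plan Z₂ → Z₁ ≈ₛ Z₂ → Plan Z₁
    join   : ∀ {Z₁ Z₂} → Plan Z₁ → Plan Z₂ → Plan (Z₁ ++ Z₂)
    proj   : ∀ {Z'} → Plan Z' → (Z : VarSet) → Z ⊆ Z' → Plan Z
    selv   : ∀ {Z} → Plan Z → (x y : Var) → x ∈ Z → y ∈ Z → Plan Z
    selc   : ∀ {Z} → Plan Z → (x : Var) (c : Dom) → x ∈ Z → Plan Z
    gprojv : ∀ {Z'} → Plan Z' → (Z : VarSet) (x y : Var)
           → Z ⊆ Z' → y ∈ Z' → x ∉ Z → Plan (x ∷ Z)
    gprojc : ∀ {Z'} → Plan Z' → (Z : VarSet) (x : Var) (c : Dom)
           → Z ⊆ Z' → x ∉ Z → Plan (x ∷ Z)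

-- E(D,N), as a predicate on total valuations, read via restriction to the
-- output schema of E.
⟦_⟧ₚ : ∀ {S In Z} → Plan S In Z → Instance S → (Val → Set) → Val → Set
⟦_⟧ₚ {In = In} inp D N ν = ∃ λ μ → N μ × (μ ≈[ In ] ν)
⟦ access E R xs ys _ _ _ ⟧ₚ D N ν =
  ⟦ E ⟧ₚ D N ν × ((Vec.map ν xs Vec.++ Vec.map ν ys) ∈ D R)
⟦ union E₁ E₂ _ ⟧ₚ D N ν = ⟦ E₁ ⟧ₚ D N ν ⊎ ⟦ E₂ ⟧ₚ D N ν
⟦ diff E₁ E₂ _ ⟧ₚ D N ν = ⟦ E₁ ⟧ₚ D N ν × ¬ ⟦ E₂ ⟧ₚ D N ν
⟦ join E₁ E₂ ⟧ₚ D N ν = ⟦ E₁ ⟧ₚ D N ν × ⟦ E₂ ⟧ₚ D N ν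
⟦ proj E Z _ ⟧ₚ D N ν = ∃ λ μ → ⟦ E ⟧ₚ D N μ × (μ ≈[ Z ] ν)
⟦ selv E x y _ _ ⟧ₚ D N ν = ⟦ E ⟧ₚ D N ν × ν x ≡ ν y
⟦ selc E x c _ ⟧ₚ D N ν = ⟦ E ⟧ₚ D N ν × ν x ≡ c
⟦ gprojv E Z x y _ _ _ ⟧ₚ D N ν = ∃ λ μ → ⟦ E ⟧ₚ D N μ × (μ ≈[ Z ] ν) × ν x ≡ μ y
⟦ gprojc E Z x c _ _ ⟧ₚ D N ν = ∃ λ μ → ⟦ E ⟧ₚ D N μ × (μ ≈[ Z ] ν) × ν x ≡ c

-- For an io-disjoint α, a pair (ν₁, ν₂) ∈ ⟦α⟧ is determined by ν₁ on I(α) and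
-- ν₂ on O(α), the remaining variables being carried over unchanged; in
-- particular ν₂ is then a fixpoint, (ν₂, ν₂) ∈ ⟦α⟧.  So α can be compiled,
-- relative to a plan F whose schema Z contains I(α), into a plan over the
-- schema (Z ∖ O(α)) ∪ vars(α) whose tuples are exactly the fixpoints of α
-- that agree with some tuple of F outside O(α).  Atomic expressions become an
-- access, a selection or a generalised projection on top of F; α ; β compiles
-- β on top of the plan for α; ∪ and − become union and difference, which is
-- possible because io-disjointness forces O(α) = O(β) (resp. O(α) ⊆ O(β)).
-- Projecting the compiled plan for F = In onto vars(α) yields Eval_α.

module Submission where

open import Defs

open import Data.Empty using (⊥-elim)
open import Data.List using ([]; _∷_; _++_)
open import Data.Nat using (_≟_)
open import Data.List.Membership.DecPropositional _≟_ using (_∈?_)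
open import Data.List.Membership.Propositional using (_∈_; _∉_)
open import Data.List.Membership.Propositional.Properties
  using (∈-++⁺ˡ; ∈-++⁺ʳ; ∈-++⁻; ∈-filter⁺; ∈-filter⁻)
open import Data.List.Relation.Unary.Any using (here; there)
open import Data.Product using (Σ; ∃; _×_; _,_; proj₁; proj₂; map₁; map₂)
open import Data.Product.Function.NonDependent.Propositional using (_×-⇔_)
open import Data.Sum using (_⊎_; inj₁; inj₂; [_,_]′)
open import Data.Vec using (Vec)
import Data.Vec as Vec
open import Function using (_∘_; id)
open import Function.Bundles using (_⇔_; mk⇔; module Equivalence)
open import Function.Construct.Composition using (_⇔-∘_)
open import Function.Construct.Identity using (⇔-id)
open import Relation.Binary.PropositionalEquality
  using (_≡_; refl; sym; trans; cong₂; subst; module ≡-Reasoning)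
open import Relation.Nullary using (yes; no)
open import Relation.Nullary.Decidable using (¬?; toSum)

open Equivalence using (to; from)
open ≡-Reasoning

∈-or-∉ : ∀ z (A : VarSet) → z ∈ A ⊎ z ∉ A
∈-or-∉ z A = toSum (z ∈? A)

∉-++⁺ : ∀ {z} {A B : VarSet} → z ∉ A → z ∉ B → z ∉ A ++ B
∉-++⁺ {A = A} z∉A z∉B z∈ = [ z∉A , z∉B ]′ (∈-++⁻ A z∈)

++-⊆ : ∀ (A : VarSet) {B C} → A ⊆ C → B ⊆ C → (A ++ B) ⊆ C
++-⊆ A A⊆C B⊆C z∈ = [ A⊆C , B⊆C ]′ (∈-++⁻ A z∈)

∈-∖⁺ : ∀ {z} {A B : VarSet} → z ∈ A → z ∉ B → z ∈ A ∖ B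
∈-∖⁺ {B = B} = ∈-filter⁺ (λ z → ¬? (z ∈? B))

∈-∖⁻ : ∀ {z} (A : VarSet) {B : VarSet} → z ∈ A ∖ B → z ∈ A × z ∉ B
∈-∖⁻ A {B} = ∈-filter⁻ (λ z → ¬? (z ∈? B)) {xs = A}

∖-⊆ : ∀ (A : VarSet) {B} → (A ∖ B) ⊆ A
∖-⊆ A = proj₁ ∘ ∈-∖⁻ A

∖-antimono : ∀ (A : VarSet) {B C} → B ⊆ C → (A ∖ C) ⊆ (A ∖ B)
∖-antimono A B⊆C z∈ = let (z∈A , z∉C) = ∈-∖⁻ A z∈ in ∈-∖⁺ z∈A (z∉C ∘ B⊆C)

∖-disjoint⇒⊆ : ∀ {A B : VarSet} → Disjoint (A ∖ B) A → A ⊆ B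
∖-disjoint⇒⊆ {B = B} disj {z} z∈A with ∈-or-∉ z B
... | inj₁ z∈B = z∈B
... | inj₂ z∉B = ⊥-elim (disj (∈-∖⁺ z∈A z∉B) z∈A)

_≈[_]ᶜ_ : Val → VarSet → Val → Set
ν ≈[ A ]ᶜ μ = ∀ {z} → z ∉ A → ν z ≡ μ z

override : VarSet → Val → Val → Val
override A ν μ z with z ∈? A
... | yes _ = ν z
... | no  _ = μ z

override-∈ : ∀ A ν μ → override A ν μ ≈[ A ] ν
override-∈ A ν μ {z} z∈A with z ∈? A
... | yes _   = refl
... | no  z∉A = ⊥-elim (z∉A z∈A)

override-∉ : ∀ A ν μ → override A ν μ ≈[ A ]ᶜ μ
override-∉ A ν μ {z} z∉A with z ∈? A
... | yes z∈A = ⊥-elim (z∉A z∈A)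
... | no  _   = refl

map-cong-on : ∀ {n} (xs : Vec Var n) {ν μ : Val} →
              ν ≈[ Vec.toList xs ] μ → Vec.map ν xs ≡ Vec.map μ xs
map-cong-on Vec.[]       _   = refl
map-cong-on (x Vec.∷ xs) ν≈μ = cong₂ Vec._∷_ (ν≈μ (here refl)) (map-cong-on xs (ν≈μ ∘ there))

AgreesWithSome : VarSet → (Val → Set) → Val → Set
AgreesWithSome B N ν = ∃ λ μ → N μ × μ ≈[ B ] ν

AgreesWithSome-antimono : ∀ {B B′ N ν} → B′ ⊆ B → AgreesWithSome B N ν → AgreesWithSome B′ N ν
AgreesWithSome-antimono B′⊆B (μ , μ∈N , μ≈ν) = μ , μ∈N , μ≈ν ∘ B′⊆B

AgreesWithSome-resp : ∀ {B N μ ν} → AgreesWithSome B N μ → μ ≈[ B ] ν → AgreesWithSome B N ν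
AgreesWithSome-resp (ρ , ρ∈N , ρ≈μ) μ≈ν = ρ , ρ∈N , λ z∈ → trans (ρ≈μ z∈) (μ≈ν z∈)

AgreesWithSome-absorb : ∀ {A B N ν} → A ⊆ B →
                        AgreesWithSome B (AgreesWithSome A N) ν ⇔ AgreesWithSome A N ν
AgreesWithSome-absorb {ν = ν} A⊆B = mk⇔
  (λ (ρ , w , ρ≈ν) → AgreesWithSome-resp w (ρ≈ν ∘ A⊆B))
  (λ w → ν , w , λ {_} _ → refl)

module _ {S : Schema} where

  IODisjoint⇒Disjoint : ∀ (α : Expr S) → IODisjoint α → Disjoint (I α) (O α)
  IODisjoint⇒Disjoint (atom R xs ys) d = d
  IODisjoint⇒Disjoint (eqv x y)      d = d
  IODisjoint⇒Disjoint (eqc x c)      d = d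
  IODisjoint⇒Disjoint (asv x y)      d = d
  IODisjoint⇒Disjoint (asc x c)      d = d
  IODisjoint⇒Disjoint (a ⨾ b)        (d , _) = d
  IODisjoint⇒Disjoint (a ∪ₑ b)       (d , _) = d
  IODisjoint⇒Disjoint (a −ₑ b)       (d , _) = d

  O⊆vars : ∀ (α : Expr S) → O α ⊆ vars α
  O⊆vars (atom R xs ys) = ∈-++⁺ʳ (Vec.toList xs)
  O⊆vars (eqv x y)      ()
  O⊆vars (eqc x c)      ()
  O⊆vars (asv x y)      (here z≡x) = here z≡x
  O⊆vars (asc x c)      = id
  O⊆vars (a ⨾ b)        = ++-⊆ (O a) (∈-++⁺ˡ ∘ O⊆vars a) (∈-++⁺ʳ (vars a) ∘ O⊆vars b)
  O⊆vars (a ∪ₑ b)       = ++-⊆ (O a) (∈-++⁺ˡ ∘ O⊆vars a) (∈-++⁺ʳ (vars a) ∘ O⊆vars b)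
  O⊆vars (a −ₑ b)       = ∈-++⁺ˡ ∘ O⊆vars a

  binary-I⊆vars : ∀ (a b : Expr S) → I a ⊆ vars a → I b ⊆ vars b →
                  (I a ++ I b ++ (O a △ O b)) ⊆ (vars a ++ vars b)
  binary-I⊆vars a b Ia⊆ Ib⊆ =
    ++-⊆ (I a) (∈-++⁺ˡ ∘ Ia⊆) (++-⊆ (I b) (∈-++⁺ʳ (vars a) ∘ Ib⊆)
      (++-⊆ (O a ∖ O b) (∈-++⁺ˡ ∘ O⊆vars a ∘ ∖-⊆ (O a)) (∈-++⁺ʳ (vars a) ∘ O⊆vars b ∘ ∖-⊆ (O b))))

  I⊆vars : ∀ (α : Expr S) → I α ⊆ vars α
  I⊆vars (atom R xs ys) = ∈-++⁺ˡ
  I⊆vars (eqv x y)      = id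
  I⊆vars (eqc x c)      = id
  I⊆vars (asv x y)      = there
  I⊆vars (asc x c)      ()
  I⊆vars (a ⨾ b)        = ++-⊆ (I a) (∈-++⁺ˡ ∘ I⊆vars a) (∈-++⁺ʳ (vars a) ∘ I⊆vars b ∘ ∖-⊆ (I b))
  I⊆vars (a ∪ₑ b)       = binary-I⊆vars a b (I⊆vars a) (I⊆vars b)
  I⊆vars (a −ₑ b)       = binary-I⊆vars a b (I⊆vars a) (I⊆vars b)

  vars⊆I∪O : ∀ (α : Expr S) {z} → z ∈ vars α → z ∈ I α ⊎ z ∈ O α
  vars⊆I∪O (atom R xs ys) z∈ = ∈-++⁻ (Vec.toList xs) z∈
  vars⊆I∪O (eqv x y)      z∈ = inj₁ z∈
  vars⊆I∪O (eqc x c)      z∈ = inj₁ z∈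
  vars⊆I∪O (asv x y)      (here z≡x) = inj₂ (here z≡x)
  vars⊆I∪O (asv x y)      (there z∈) = inj₁ z∈
  vars⊆I∪O (asc x c)      z∈ = inj₂ z∈
  vars⊆I∪O (a ⨾ b) {z}    z∈ with ∈-++⁻ (vars a) z∈
  ... | inj₁ z∈a = [ inj₁ ∘ ∈-++⁺ˡ , inj₂ ∘ ∈-++⁺ˡ ]′ (vars⊆I∪O a z∈a)
  ... | inj₂ z∈b with vars⊆I∪O b z∈b | ∈-or-∉ z (O a)
  ...   | inj₂ z∈Ob | _         = inj₂ (∈-++⁺ʳ (O a) z∈Ob)
  ...   | inj₁ _    | inj₁ z∈Oa = inj₂ (∈-++⁺ˡ z∈Oa)
  ...   | inj₁ z∈Ib | inj₂ z∉Oa = inj₁ (∈-++⁺ʳ (I a) (∈-∖⁺ z∈Ib z∉Oa))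
  vars⊆I∪O (a ∪ₑ b)       z∈ with ∈-++⁻ (vars a) z∈
  ... | inj₁ z∈a = [ inj₁ ∘ ∈-++⁺ˡ , inj₂ ∘ ∈-++⁺ˡ ]′ (vars⊆I∪O a z∈a)
  ... | inj₂ z∈b = [ inj₁ ∘ ∈-++⁺ʳ (I a) ∘ ∈-++⁺ˡ , inj₂ ∘ ∈-++⁺ʳ (O a) ]′ (vars⊆I∪O b z∈b)
  vars⊆I∪O (a −ₑ b) {z}   z∈ with ∈-++⁻ (vars a) z∈
  ... | inj₁ z∈a = [ inj₁ ∘ ∈-++⁺ˡ , inj₂ ]′ (vars⊆I∪O a z∈a)
  ... | inj₂ z∈b with vars⊆I∪O b z∈b | ∈-or-∉ z (O a)
  ...   | inj₁ z∈Ib | _         = inj₁ (∈-++⁺ʳ (I a) (∈-++⁺ˡ z∈Ib))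
  ...   | inj₂ _    | inj₁ z∈Oa = inj₂ z∈Oa
  ...   | inj₂ z∈Ob | inj₂ z∉Oa =
    inj₁ (∈-++⁺ʳ (I a) (∈-++⁺ʳ (I b) (∈-++⁺ʳ (O a ∖ O b) (∈-∖⁺ z∈Ob z∉Oa))))

  ∪-outputs : ∀ {a b : Expr S} → IODisjoint (a ∪ₑ b) → O a ⊆ O b × O b ⊆ O a
  ∪-outputs {a} {b} (d , _) =
    ∖-disjoint⇒⊆ (λ z∈ z∈Oa → d (∈-++⁺ʳ (I a) (∈-++⁺ʳ (I b) (∈-++⁺ˡ z∈))) (∈-++⁺ˡ z∈Oa)) ,
    ∖-disjoint⇒⊆ (λ z∈ z∈Ob → d (∈-++⁺ʳ (I a) (∈-++⁺ʳ (I b) (∈-++⁺ʳ (O a ∖ O b) z∈)))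
                                  (∈-++⁺ʳ (O a) z∈Ob))

  −-outputs : ∀ {a b : Expr S} → IODisjoint (a −ₑ b) → O a ⊆ O b
  −-outputs {a} {b} (d , _) =
    ∖-disjoint⇒⊆ (λ z∈ z∈Oa → d (∈-++⁺ʳ (I a) (∈-++⁺ʳ (I b) (∈-++⁺ˡ z∈))) z∈Oa)

  schema : VarSet → Expr S → VarSet
  schema Z α = (Z ∖ O α) ++ vars α

  schema-split : ∀ {Z} (α : Expr S) → Disjoint (I α) (O α) → I α ⊆ Z →
                 ∀ {z} → z ∈ schema Z α → z ∈ Z ∖ O α ⊎ z ∈ O α
  schema-split {Z} α disj I⊆Z z∈ with ∈-++⁻ (Z ∖ O α) z∈
  ... | inj₁ z∈Z∖O = inj₁ z∈Z∖O
  ... | inj₂ z∈vars = [ (λ z∈I → inj₁ (∈-∖⁺ (I⊆Z z∈I) (disj z∈I))) , inj₂ ]′ (vars⊆I∪O α z∈vars)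

  schema-merge : ∀ {Z A} (α : Expr S) → A ⊆ vars α →
                 ∀ {z} → z ∈ Z ∖ A ⊎ z ∈ A → z ∈ schema Z α
  schema-merge {Z} α _ {z} (inj₁ z∈Z∖A) with ∈-or-∉ z (O α)
  ... | inj₁ z∈O = ∈-++⁺ʳ (Z ∖ O α) (O⊆vars α z∈O)
  ... | inj₂ z∉O = ∈-++⁺ˡ (∈-∖⁺ (∖-⊆ Z z∈Z∖A) z∉O)
  schema-merge {Z} α A⊆vars (inj₂ z∈A) = ∈-++⁺ʳ (Z ∖ O α) (A⊆vars z∈A)

  ⨾-Z∖O⊆schema∖Ob : ∀ Z (a b : Expr S) → (Z ∖ O (a ⨾ b)) ⊆ (schema Z a ∖ O b)
  ⨾-Z∖O⊆schema∖Ob Z a b z∈ =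
    ∈-∖⁺ (∈-++⁺ˡ (∖-antimono Z ∈-++⁺ˡ z∈)) (proj₂ (∈-∖⁻ Z z∈) ∘ ∈-++⁺ʳ (O a))

  ⨾-Ib⊆schema : ∀ {Z} {a b : Expr S} → I (a ⨾ b) ⊆ Z → I b ⊆ schema Z a
  ⨾-Ib⊆schema {Z} {a} I⊆Z {z} z∈Ib with ∈-or-∉ z (O a)
  ... | inj₁ z∈Oa = ∈-++⁺ʳ (Z ∖ O a) (O⊆vars a z∈Oa)
  ... | inj₂ z∉Oa = ∈-++⁺ˡ (∈-∖⁺ (I⊆Z (∈-++⁺ʳ (I a) (∈-∖⁺ z∈Ib z∉Oa))) z∉Oa)

  ⨾-schema⊆ : ∀ Z (a b : Expr S) → schema Z (a ⨾ b) ⊆ schema (schema Z a) b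
  ⨾-schema⊆ Z a b {z} z∈ with ∈-++⁻ (Z ∖ O (a ⨾ b)) z∈
  ... | inj₁ z∈Z∖O = ∈-++⁺ˡ (⨾-Z∖O⊆schema∖Ob Z a b z∈Z∖O)
  ... | inj₂ z∈vars with ∈-++⁻ (vars a) z∈vars | ∈-or-∉ z (O b)
  ...   | inj₂ z∈b | _         = ∈-++⁺ʳ (schema Z a ∖ O b) z∈b
  ...   | inj₁ _   | inj₁ z∈Ob = ∈-++⁺ʳ (schema Z a ∖ O b) (O⊆vars b z∈Ob)
  ...   | inj₁ z∈a | inj₂ z∉Ob = ∈-++⁺ˡ (∈-∖⁺ (∈-++⁺ʳ (Z ∖ O a) z∈a) z∉Ob)

-- Semantics of io-disjoint expressions

Local : ∀ {S} → Instance S → Expr S → Set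
Local D α = ∀ {ν₁ ν₂ ν₁′ ν₂′} → ⟦ α ⟧ₑ D ν₁ ν₂ →
            ν₁′ ≈[ I α ] ν₁ → ν₂′ ≈[ O α ] ν₂ → ν₁′ ≈[ O α ]ᶜ ν₂′ → ⟦ α ⟧ₑ D ν₁′ ν₂′

module _ {S : Schema} {D : Instance S} where

  ⟦⟧-frame : ∀ (α : Expr S) {ν₁ ν₂} → ⟦ α ⟧ₑ D ν₁ ν₂ → ν₁ ≈[ O α ]ᶜ ν₂
  ⟦⟧-frame (atom R xs ys) (_ , frame) z∉ = frame _ z∉
  ⟦⟧-frame (eqv x y)      (same , _)  _  = same _
  ⟦⟧-frame (eqc x c)      (same , _)  _  = same _
  ⟦⟧-frame (asv x y)      (_ , frame) z∉ = frame _ (z∉ ∘ here)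
  ⟦⟧-frame (asc x c)      (_ , frame) z∉ = frame _ (z∉ ∘ here)
  ⟦⟧-frame (a ⨾ b)        (_ , p , q) z∉ =
    trans (⟦⟧-frame a p (z∉ ∘ ∈-++⁺ˡ)) (⟦⟧-frame b q (z∉ ∘ ∈-++⁺ʳ (O a)))
  ⟦⟧-frame (a ∪ₑ b)       (inj₁ p)    z∉ = ⟦⟧-frame a p (z∉ ∘ ∈-++⁺ˡ)
  ⟦⟧-frame (a ∪ₑ b)       (inj₂ q)    z∉ = ⟦⟧-frame b q (z∉ ∘ ∈-++⁺ʳ (O a))
  ⟦⟧-frame (a −ₑ b)       (p , _)     z∉ = ⟦⟧-frame a p z∉

  ⨾-local : ∀ {a b : Expr S} → Local D a → Local D b → Local D (a ⨾ b)
  ⨾-local {a} {b} local-a local-b {ν₁} {ν₂} {ν₁′} {ν₂′} (ν , p , q) ≈I ≈O ≈ᶜ =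
    κ , local-a p (≈I ∘ ∈-++⁺ˡ) (override-∈ (O a) ν ν₁′) (sym ∘ override-∉ (O a) ν ν₁′) ,
        local-b q κ≈[Ib]ν (≈O ∘ ∈-++⁺ʳ (O a)) κ≈ν₂′
    where
    κ : Val
    κ = override (O a) ν ν₁′
    κ≈[Ib]ν : κ ≈[ I b ] ν
    κ≈[Ib]ν {z} z∈Ib with ∈-or-∉ z (O a)
    ... | inj₁ z∈Oa = override-∈ (O a) ν ν₁′ z∈Oa
    ... | inj₂ z∉Oa = begin
      κ z   ≡⟨ override-∉ (O a) ν ν₁′ z∉Oa ⟩
      ν₁′ z ≡⟨ ≈I (∈-++⁺ʳ (I a) (∈-∖⁺ z∈Ib z∉Oa)) ⟩
      ν₁ z  ≡⟨ ⟦⟧-frame a p z∉Oa ⟩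
      ν z   ∎
    κ≈ν₂′ : κ ≈[ O b ]ᶜ ν₂′
    κ≈ν₂′ {z} z∉Ob with ∈-or-∉ z (O a)
    ... | inj₁ z∈Oa = begin
      κ z   ≡⟨ override-∈ (O a) ν ν₁′ z∈Oa ⟩
      ν z   ≡⟨ ⟦⟧-frame b q z∉Ob ⟩
      ν₂ z  ≡⟨ sym (≈O (∈-++⁺ˡ z∈Oa)) ⟩
      ν₂′ z ∎
    ... | inj₂ z∉Oa = trans (override-∉ (O a) ν ν₁′ z∉Oa) (≈ᶜ (∉-++⁺ z∉Oa z∉Ob))

  ∪-local : ∀ {a b : Expr S} → O a ⊆ O b → O b ⊆ O a → Local D a → Local D b → Local D (a ∪ₑ b)
  ∪-local Oa⊆Ob Ob⊆Oa local-a local-b (inj₁ p) ≈I ≈O ≈ᶜ =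
    inj₁ (local-a p (≈I ∘ ∈-++⁺ˡ) (≈O ∘ ∈-++⁺ˡ) (λ z∉ → ≈ᶜ (∉-++⁺ z∉ (z∉ ∘ Ob⊆Oa))))
  ∪-local {a} Oa⊆Ob Ob⊆Oa local-a local-b (inj₂ q) ≈I ≈O ≈ᶜ =
    inj₂ (local-b q (≈I ∘ ∈-++⁺ʳ (I a) ∘ ∈-++⁺ˡ) (≈O ∘ ∈-++⁺ʳ (O a))
                    (λ z∉ → ≈ᶜ (∉-++⁺ (z∉ ∘ Oa⊆Ob) z∉)))

  −-local : ∀ {a b : Expr S} → O a ⊆ O b → Local D a → Local D b → Local D (a −ₑ b)
  −-local {a} {b} Oa⊆Ob local-a local-b {ν₁} {ν₂} {ν₁′} {ν₂′} (p , ¬q) ≈I ≈O ≈ᶜ =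
    local-a p (≈I ∘ ∈-++⁺ˡ) ≈O ≈ᶜ ,
    λ q′ → ¬q (local-b q′ (sym ∘ ≈I ∘ ∈-++⁺ʳ (I a) ∘ ∈-++⁺ˡ) ν₂≈ν₂′
                          (λ z∉Ob → ⟦⟧-frame a p (z∉Ob ∘ Oa⊆Ob)))
    where
    ν₂≈ν₂′ : ν₂ ≈[ O b ] ν₂′
    ν₂≈ν₂′ {z} z∈Ob with ∈-or-∉ z (O a)
    ... | inj₁ z∈Oa = sym (≈O z∈Oa)
    ... | inj₂ z∉Oa = begin
      ν₂ z  ≡⟨ sym (⟦⟧-frame a p z∉Oa) ⟩
      ν₁ z  ≡⟨ sym (≈I (∈-++⁺ʳ (I a) (∈-++⁺ʳ (I b) (∈-++⁺ʳ (O a ∖ O b) (∈-∖⁺ z∈Ob z∉Oa))))) ⟩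
      ν₁′ z ≡⟨ ≈ᶜ z∉Oa ⟩
      ν₂′ z ∎

  ⟦⟧-local : ∀ (α : Expr S) → IODisjoint α → Local D α
  ⟦⟧-local (atom R xs ys) _ (t∈ , _) ≈I ≈O ≈ᶜ =
    subst (_∈ D R) (sym (cong₂ Vec._++_ (map-cong-on xs ≈I) (map-cong-on ys ≈O))) t∈ ,
    λ _ → ≈ᶜ
  ⟦⟧-local (eqv x y) _ (_ , x≡y) ≈I _ ≈ᶜ =
    (λ _ → ≈ᶜ λ ()) , trans (≈I (here refl)) (trans x≡y (sym (≈I (there (here refl)))))
  ⟦⟧-local (eqc x c) _ (_ , x≡c) ≈I _ ≈ᶜ =
    (λ _ → ≈ᶜ λ ()) , trans (≈I (here refl)) x≡c
  ⟦⟧-local (asv x y) _ (x≡y , _) ≈I ≈O ≈ᶜ =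
    trans (≈O (here refl)) (trans x≡y (sym (≈I (here refl)))) ,
    λ _ z≢x → ≈ᶜ λ { (here z≡x) → z≢x z≡x }
  ⟦⟧-local (asc x c) _ (x≡c , _) _ ≈O ≈ᶜ =
    trans (≈O (here refl)) x≡c , λ _ z≢x → ≈ᶜ λ { (here z≡x) → z≢x z≡x }
  ⟦⟧-local (a ⨾ b)  (_ , da , db) = ⨾-local (⟦⟧-local a da) (⟦⟧-local b db)
  ⟦⟧-local (a ∪ₑ b) d@(_ , da , db) =
    ∪-local (proj₁ (∪-outputs d)) (proj₂ (∪-outputs d)) (⟦⟧-local a da) (⟦⟧-local b db)
  ⟦⟧-local (a −ₑ b) d@(_ , da , db) = −-local (−-outputs d) (⟦⟧-local a da) (⟦⟧-local b db)

  ⟦⟧-fixpoint : ∀ (α : Expr S) → IODisjoint α → ∀ {ν₁ ν₂} → ⟦ α ⟧ₑ D ν₁ ν₂ → ⟦ α ⟧ₑ D ν₂ ν₂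
  ⟦⟧-fixpoint α d p =
    ⟦⟧-local α d p (sym ∘ ⟦⟧-frame α p ∘ IODisjoint⇒Disjoint α d) (λ {_} _ → refl) (λ {_} _ → refl)

  ⟦⟧-fixpoint-resp : ∀ (α : Expr S) → IODisjoint α → ∀ {μ ν} →
                     ⟦ α ⟧ₑ D μ μ → μ ≈[ vars α ] ν → ⟦ α ⟧ₑ D ν ν
  ⟦⟧-fixpoint-resp α d p μ≈ν =
    ⟦⟧-local α d p (sym ∘ μ≈ν ∘ I⊆vars α) (sym ∘ μ≈ν ∘ O⊆vars α) (λ {_} _ → refl)

-- Compiling io-disjoint expressions into plans

module _ {S : Schema} {In : VarSet} where

  Computes : ∀ {Z Z′} → Expr S → Plan S In Z → Plan S In Z′ → Set₁
  Computes {Z} α F E =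
    ∀ D N ν → ⟦ E ⟧ₚ D N ν ⇔ (AgreesWithSome (Z ∖ O α) (⟦ F ⟧ₚ D N) ν × ⟦ α ⟧ₑ D ν ν)

  Compiled : ∀ {Z} → Expr S → Plan S In Z → Set₁
  Compiled {Z} α F = Σ (Plan S In (schema Z α)) (Computes α F)

  Computes-proj : ∀ {Z Z′} (α : Expr S) {F : Plan S In Z} → IODisjoint α → (E : Plan S In Z′) →
                  (W : VarSet) (W⊆Z′ : W ⊆ Z′) → (Z ∖ O α) ⊆ W → vars α ⊆ W →
                  Computes α F E → Computes α F (proj E W W⊆Z′)
  Computes-proj α d E W _ Z∖O⊆W vars⊆W E-computes D N ν = mk⇔
    (λ (μ , μ∈E , μ≈ν) → let (w , p) = to (E-computes D N μ) μ∈E in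
       AgreesWithSome-resp w (μ≈ν ∘ Z∖O⊆W) , ⟦⟧-fixpoint-resp α d p (μ≈ν ∘ vars⊆W))
    (λ wp → ν , from (E-computes D N ν) wp , λ {_} _ → refl)

  restrict-to-schema : ∀ {Z Z′} (α : Expr S) {F : Plan S In Z} → IODisjoint α → (E : Plan S In Z′) →
                       schema Z α ⊆ Z′ → Computes α F E → Compiled α F
  restrict-to-schema {Z} α d E schema⊆Z′ E-computes =
    proj E (schema Z α) schema⊆Z′ ,
    Computes-proj α d E _ schema⊆Z′ ∈-++⁺ˡ (∈-++⁺ʳ (Z ∖ O α)) E-computes

  forget : ∀ {Z} → Plan S In Z → (A : VarSet) → Plan S In (Z ∖ A)
  forget F A = proj F _ (∖-⊆ _)

  Compiler : Expr S → Set₁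
  Compiler α = ∀ {Z} (F : Plan S In Z) → IODisjoint α → I α ⊆ Z → Compiled α F

  atom-plan : ∀ {R xs ys} → Compiler (atom R xs ys)
  atom-plan {R} {xs} {ys} {Z} F d I⊆Z = restrict-to-schema (atom R xs ys) d E
    ([ ∈-++⁺ˡ , ∈-++⁺ʳ _ ]′ ∘ schema-split {S = S} (atom R xs ys) d I⊆Z)
    (λ D N ν → mk⇔ (λ (w , t∈) → w , t∈ , λ _ _ → refl) (λ (w , t∈ , _) → w , t∈))
    where
    E : Plan S In ((Z ∖ Vec.toList ys) ++ Vec.toList ys)
    E = access (forget F (Vec.toList ys)) R xs ys d (λ z∈ → ∈-∖⁺ (I⊆Z z∈) (d z∈))
               (λ z∈ → proj₂ (∈-∖⁻ Z z∈))

  eqv-plan : ∀ {x y : Var} → Compiler (eqv x y)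
  eqv-plan {x} {y} {Z} F d I⊆Z = restrict-to-schema (eqv x y) d
    (selv (forget F []) x y (∈-∖⁺ (I⊆Z (here refl)) λ ()) (∈-∖⁺ (I⊆Z (there (here refl))) λ ()))
    ([ id , (λ ()) ]′ ∘ schema-split {S = S} (eqv x y) d I⊆Z)
    (λ D N ν → mk⇔ (λ (w , x≡y) → w , (λ _ → refl) , x≡y) (λ (w , _ , x≡y) → w , x≡y))

  eqc-plan : ∀ {x : Var} {c : Dom} → Compiler (eqc x c)
  eqc-plan {x} {c} {Z} F d I⊆Z = restrict-to-schema (eqc x c) d
    (selc (forget F []) x c (∈-∖⁺ (I⊆Z (here refl)) λ ()))
    ([ id , (λ ()) ]′ ∘ schema-split {S = S} (eqc x c) d I⊆Z)
    (λ D N ν → mk⇔ (λ (w , x≡c) → w , (λ _ → refl) , x≡c) (λ (w , _ , x≡c) → w , x≡c))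

  asv-plan : ∀ {x y : Var} → Compiler (asv x y)
  asv-plan {x} {y} {Z} F d I⊆Z = restrict-to-schema (asv x y) d
    (gprojv (forget F (x ∷ [])) _ x y id y∈ (λ x∈ → proj₂ (∈-∖⁻ Z x∈) (here refl)))
    ([ there , (λ { (here z≡x) → here z≡x }) ]′ ∘ schema-split {S = S} (asv x y) d I⊆Z)
    (λ D N ν → mk⇔
      (λ (μ , w , μ≈ν , x≡y) → AgreesWithSome-resp w μ≈ν , trans x≡y (μ≈ν y∈) , λ _ _ → refl)
      (λ (w , x≡y , _) → ν , w , (λ {_} _ → refl) , x≡y))
    where
    y∈ : y ∈ Z ∖ (x ∷ [])
    y∈ = ∈-∖⁺ (I⊆Z (here refl)) (d (here refl))

  asc-plan : ∀ {x : Var} {c : Dom} → Compiler (asc x c)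
  asc-plan {x} {c} {Z} F d I⊆Z = restrict-to-schema (asc x c) d
    (gprojc (forget F (x ∷ [])) _ x c id (λ x∈ → proj₂ (∈-∖⁻ Z x∈) (here refl)))
    ([ there , (λ { (here z≡x) → here z≡x }) ]′ ∘ schema-split {S = S} (asc x c) d I⊆Z)
    (λ D N ν → mk⇔
      (λ (μ , w , μ≈ν , x≡c) → AgreesWithSome-resp w μ≈ν , x≡c , λ _ _ → refl)
      (λ (w , x≡c , _) → ν , w , (λ {_} _ → refl) , x≡c))

  module _ {a b : Expr S} {Z : VarSet} {F : Plan S In Z} {Ea : Plan S In (schema Z a)}
           (d : IODisjoint (a ⨾ b)) (I⊆Z : I (a ⨾ b) ⊆ Z) (Ea-computes : Computes a F Ea)
           {D : Instance S} {N : Val → Set} where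

    private
      da : IODisjoint a
      da = proj₁ (proj₂ d)

      db : IODisjoint b
      db = proj₂ (proj₂ d)

      Ia∩Ob=∅ : Disjoint (I a) (O b)
      Ia∩Ob=∅ z∈Ia z∈Ob = proj₁ d (∈-++⁺ˡ z∈Ia) (∈-++⁺ʳ (O a) z∈Ob)

    ⨾-sound : ∀ {ν} → AgreesWithSome (schema Z a ∖ O b) (⟦ Ea ⟧ₚ D N) ν × ⟦ b ⟧ₑ D ν ν →
              AgreesWithSome (Z ∖ O (a ⨾ b)) (⟦ F ⟧ₚ D N) ν × ⟦ a ⨾ b ⟧ₑ D ν ν
    ⨾-sound {ν} ((μ , μ∈Ea , μ≈ν) , q) with to (Ea-computes D N μ) μ∈Ea
    ... | (μ₀ , μ₀∈F , μ₀≈μ) , p =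
      (μ₀ , μ₀∈F , λ z∈ → trans (μ₀≈μ (∖-antimono Z ∈-++⁺ˡ z∈)) (μ≈ν (⨾-Z∖O⊆schema∖Ob Z a b z∈))) ,
      κ , ⟦⟧-local a da p ν≈[Ia]μ (override-∈ (O a) μ ν) (sym ∘ override-∉ (O a) μ ν) ,
          ⟦⟧-local b db q (κ≈ν ∘ IODisjoint⇒Disjoint b db) (λ {_} _ → refl) κ≈ν
      where
      κ : Val
      κ = override (O a) μ ν
      ν≈[Ia]μ : ν ≈[ I a ] μ
      ν≈[Ia]μ z∈Ia = sym (μ≈ν (∈-∖⁺ (∈-++⁺ʳ (Z ∖ O a) (I⊆vars a z∈Ia)) (Ia∩Ob=∅ z∈Ia)))
      κ≈ν : κ ≈[ O b ]ᶜ ν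
      κ≈ν {z} z∉Ob with ∈-or-∉ z (O a)
      ... | inj₁ z∈Oa =
        trans (override-∈ (O a) μ ν z∈Oa) (μ≈ν (∈-∖⁺ (∈-++⁺ʳ (Z ∖ O a) (O⊆vars a z∈Oa)) z∉Ob))
      ... | inj₂ z∉Oa = override-∉ (O a) μ ν z∉Oa

    ⨾-complete : ∀ {ν} → AgreesWithSome (Z ∖ O (a ⨾ b)) (⟦ F ⟧ₚ D N) ν × ⟦ a ⨾ b ⟧ₑ D ν ν →
                 AgreesWithSome (schema Z a ∖ O b) (⟦ Ea ⟧ₚ D N) ν × ⟦ b ⟧ₑ D ν ν
    ⨾-complete {ν} ((μ₀ , μ₀∈F , μ₀≈ν) , (κ , p , q)) =
      (μ , from (Ea-computes D N μ) (μ-input , μ-fixpoint) , μ≈ν) , ⟦⟧-fixpoint b db q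
      where
      μ : Val
      μ = override (O a) κ μ₀
      μ-input : AgreesWithSome (Z ∖ O a) (⟦ F ⟧ₚ D N) μ
      μ-input = μ₀ , μ₀∈F , λ z∈ → sym (override-∉ (O a) κ μ₀ (proj₂ (∈-∖⁻ Z z∈)))
      μ≈ν-off-outputs : ∀ {z} → z ∈ Z → z ∉ O a → z ∉ O b → μ z ≡ ν z
      μ≈ν-off-outputs z∈Z z∉Oa z∉Ob =
        trans (override-∉ (O a) κ μ₀ z∉Oa) (μ₀≈ν (∈-∖⁺ z∈Z (∉-++⁺ z∉Oa z∉Ob)))
      μ-fixpoint : ⟦ a ⟧ₑ D μ μ
      μ-fixpoint = ⟦⟧-local a da p
        (λ z∈Ia → μ≈ν-off-outputs (I⊆Z (∈-++⁺ˡ z∈Ia)) (IODisjoint⇒Disjoint a da z∈Ia)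
                                  (Ia∩Ob=∅ z∈Ia))
        (override-∈ (O a) κ μ₀) (λ {_} _ → refl)
      μ≈ν : μ ≈[ schema Z a ∖ O b ] ν
      μ≈ν {z} z∈ with ∈-∖⁻ (schema Z a) z∈ | ∈-or-∉ z (O a)
      ... | _ , z∉Ob | inj₁ z∈Oa = trans (override-∈ (O a) κ μ₀ z∈Oa) (⟦⟧-frame b q z∉Ob)
      ... | z∈W , z∉Ob | inj₂ z∉Oa with schema-split a (IODisjoint⇒Disjoint a da) (I⊆Z ∘ ∈-++⁺ˡ) z∈W
      ...   | inj₁ z∈Z∖Oa = μ≈ν-off-outputs (∖-⊆ Z z∈Z∖Oa) z∉Oa z∉Ob
      ...   | inj₂ z∈Oa   = ⊥-elim (z∉Oa z∈Oa)

  ⨾-computes : ∀ {a b : Expr S} {Z Zb} {F : Plan S In Z} {Ea : Plan S In (schema Z a)}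
               {Eb : Plan S In Zb} → IODisjoint (a ⨾ b) → I (a ⨾ b) ⊆ Z →
               Computes a F Ea → Computes b Ea Eb → Computes (a ⨾ b) F Eb
  ⨾-computes d I⊆Z Ea-computes Eb-computes D N ν = mk⇔
    (⨾-sound d I⊆Z Ea-computes ∘ to (Eb-computes D N ν))
    (from (Eb-computes D N ν) ∘ ⨾-complete d I⊆Z Ea-computes)

  ⨾-compiled : ∀ {a b : Expr S} {Z} {F : Plan S In Z} {Ea : Plan S In (schema Z a)} →
               IODisjoint (a ⨾ b) → I (a ⨾ b) ⊆ Z →
               Computes a F Ea → Compiled b Ea → Compiled (a ⨾ b) F
  ⨾-compiled {a} {b} {Z} d I⊆Z Ea-computes (Eb , Eb-computes) =
    restrict-to-schema (a ⨾ b) d Eb (⨾-schema⊆ Z a b) (⨾-computes d I⊆Z Ea-computes Eb-computes)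

  ∪-computes : ∀ (a b : Expr S) {Z W} {F : Plan S In Z} (Ea Eb : Plan S In W) →
               O a ⊆ O b → O b ⊆ O a → Computes a F Ea → Computes b F Eb →
               Computes (a ∪ₑ b) F (union Ea Eb (id , id))
  ∪-computes a b {Z} Ea Eb Oa⊆Ob Ob⊆Oa Ea-computes Eb-computes D N ν = mk⇔
    [ (λ p → let (w , q) = to (Ea-computes D N ν) p in
               AgreesWithSome-antimono (∖-antimono Z ∈-++⁺ˡ) w , inj₁ q)
    , (λ p → let (w , q) = to (Eb-computes D N ν) p in
               AgreesWithSome-antimono (∖-antimono Z (∈-++⁺ʳ (O a))) w , inj₂ q) ]′
    (λ { (w , inj₁ q) → inj₁ (from (Ea-computes D N ν)
                           (AgreesWithSome-antimono (∖-antimono Z (++-⊆ (O a) id Ob⊆Oa)) w , q))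
       ; (w , inj₂ q) → inj₂ (from (Eb-computes D N ν)
                           (AgreesWithSome-antimono (∖-antimono Z (++-⊆ (O a) Oa⊆Ob id)) w , q)) })

  −-computes : ∀ (a b : Expr S) {Z W} {F : Plan S In Z} (Ea Eb : Plan S In W) →
               O a ⊆ O b → Computes a F Ea → Computes b F Eb →
               Computes (a −ₑ b) F (diff Ea Eb (id , id))
  −-computes a b {Z} Ea Eb Oa⊆Ob Ea-computes Eb-computes D N ν = mk⇔
    (λ (p , ¬p′) → let (w , q) = to (Ea-computes D N ν) p in
       w , q , λ q′ →
         ¬p′ (from (Eb-computes D N ν) (AgreesWithSome-antimono (∖-antimono Z Oa⊆Ob) w , q′)))
    (λ (w , q , ¬q′) → from (Ea-computes D N ν) (w , q) , ¬q′ ∘ proj₂ ∘ to (Eb-computes D N ν))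

  ∪-compiled : ∀ {a b : Expr S} {Z} {F : Plan S In Z} → IODisjoint (a ∪ₑ b) → I (a ∪ₑ b) ⊆ Z →
               Compiled a F → Compiled b F → Compiled (a ∪ₑ b) F
  ∪-compiled {a} {b} {Z} d@(disj , da , db) I⊆Z (Ea , Ea-computes) (Eb , Eb-computes) =
    union Ea′ Eb′ (id , id) ,
    ∪-computes a b Ea′ Eb′ Oa⊆Ob Ob⊆Oa
      (Computes-proj a da Ea W W⊆a (∈-++⁺ˡ ∘ ∖-antimono Z (++-⊆ (O a) id Ob⊆Oa))
                     (∈-++⁺ʳ (Z ∖ O (a ∪ₑ b)) ∘ ∈-++⁺ˡ) Ea-computes)
      (Computes-proj b db Eb W W⊆b (∈-++⁺ˡ ∘ ∖-antimono Z (++-⊆ (O a) Oa⊆Ob id))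
                     (∈-++⁺ʳ (Z ∖ O (a ∪ₑ b)) ∘ ∈-++⁺ʳ (vars a)) Eb-computes)
    where
    W : VarSet
    W = schema Z (a ∪ₑ b)
    Oa⊆Ob : O a ⊆ O b
    Oa⊆Ob = proj₁ (∪-outputs d)
    Ob⊆Oa : O b ⊆ O a
    Ob⊆Oa = proj₂ (∪-outputs d)
    W⊆a : W ⊆ schema Z a
    W⊆a = schema-merge {Z = Z} a (++-⊆ (O a) (O⊆vars a) (O⊆vars a ∘ Ob⊆Oa))
        ∘ schema-split {Z = Z} (a ∪ₑ b) disj I⊆Z
    W⊆b : W ⊆ schema Z b
    W⊆b = schema-merge {Z = Z} b (++-⊆ (O a) (O⊆vars b ∘ Oa⊆Ob) (O⊆vars b))
        ∘ schema-split {Z = Z} (a ∪ₑ b) disj I⊆Z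
    Ea′ Eb′ : Plan S In W
    Ea′ = proj Ea W W⊆a
    Eb′ = proj Eb W W⊆b

  −-compiled : ∀ {a b : Expr S} {Z} {F : Plan S In Z} → IODisjoint (a −ₑ b) → I (a −ₑ b) ⊆ Z →
               Compiled a F → Compiled b F → Compiled (a −ₑ b) F
  −-compiled {a} {b} {Z} d@(disj , da , db) I⊆Z (Ea , Ea-computes) (Eb , Eb-computes) =
    diff Ea′ Eb′ (id , id) ,
    −-computes a b Ea′ Eb′ Oa⊆Ob
      (Computes-proj a da Ea W W⊆a ∈-++⁺ˡ (∈-++⁺ʳ (Z ∖ O a) ∘ ∈-++⁺ˡ) Ea-computes)
      (Computes-proj b db Eb W W⊆b (∈-++⁺ˡ ∘ ∖-antimono Z Oa⊆Ob)
                     (∈-++⁺ʳ (Z ∖ O a) ∘ ∈-++⁺ʳ (vars a)) Eb-computes)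
    where
    W : VarSet
    W = schema Z (a −ₑ b)
    Oa⊆Ob : O a ⊆ O b
    Oa⊆Ob = −-outputs d
    W⊆a : W ⊆ schema Z a
    W⊆a = schema-merge {Z = Z} a (O⊆vars a) ∘ schema-split {Z = Z} (a −ₑ b) disj I⊆Z
    W⊆b : W ⊆ schema Z b
    W⊆b = schema-merge {Z = Z} b (O⊆vars b ∘ Oa⊆Ob) ∘ schema-split {Z = Z} (a −ₑ b) disj I⊆Z
    Ea′ Eb′ : Plan S In W
    Ea′ = proj Ea W W⊆a
    Eb′ = proj Eb W W⊆b

  compile : ∀ α → Compiler α
  compile (atom R xs ys) = atom-plan
  compile (eqv x y)      = eqv-plan
  compile (eqc x c)      = eqc-plan
  compile (asv x y)      = asv-plan
  compile (asc x c)      = asc-plan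
  compile (a ⨾ b) F d@(_ , da , db) I⊆Z =
    let (Ea , Ea-computes) = compile a F da (I⊆Z ∘ ∈-++⁺ˡ) in
    ⨾-compiled d I⊆Z Ea-computes (compile b Ea db (⨾-Ib⊆schema {a = a} {b = b} I⊆Z))
  compile (a ∪ₑ b) F d@(_ , da , db) I⊆Z =
    ∪-compiled d I⊆Z (compile a F da (I⊆Z ∘ ∈-++⁺ˡ)) (compile b F db (I⊆Z ∘ ∈-++⁺ʳ (I a) ∘ ∈-++⁺ˡ))
  compile (a −ₑ b) F d@(_ , da , db) I⊆Z =
    −-compiled d I⊆Z (compile a F da (I⊆Z ∘ ∈-++⁺ˡ)) (compile b F db (I⊆Z ∘ ∈-++⁺ʳ (I a) ∘ ∈-++⁺ˡ))

Eval⇔fixpoints : ∀ {S} (α : Expr S) → IODisjoint α → ∀ {D N ν} →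
  Eval α D N ν ⇔ ∃ λ μ → (AgreesWithSome (I α) N μ × ⟦ α ⟧ₑ D μ μ) × μ ≈[ vars α ] ν
Eval⇔fixpoints α d = mk⇔
  (λ (νin , νin∈N , νin′ , νin≈νin′ , νout , p , νout≈ν) →
     νout , ((νin , νin∈N , λ z∈I →
               trans (νin≈νin′ z∈I) (⟦⟧-frame α p (IODisjoint⇒Disjoint α d z∈I))) ,
             ⟦⟧-fixpoint α d p) , νout≈ν)
  (λ (μ , ((μ₀ , μ₀∈N , μ₀≈μ) , p) , μ≈ν) → μ₀ , μ₀∈N , μ , μ₀≈μ , μ , p , μ≈ν)

theorem7p1 : (S : Schema) (α : Expr S) → IODisjoint α →
    Σ (Plan S (I α) (vars α)) λ E →
      (D : Instance S) (N : Val → Set) (ν : Val) → Eval α D N ν ⇔ ⟦ E ⟧ₚ D N ν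
theorem7p1 S α d = proj E (vars α) (∈-++⁺ʳ (I α ∖ O α)) , λ D N ν → mk⇔
  (map₂ (map₁ (from (E-fixpoints D N _))) ∘ to (Eval⇔fixpoints α d))
  (from (Eval⇔fixpoints α d) ∘ map₂ (map₁ (to (E-fixpoints D N _))))
  where
  compiled : Compiled α (inp {In = I α})
  compiled = compile {In = I α} α inp d id
  E : Plan S (I α) (schema (I α) α)
  E = proj₁ compiled
  E-fixpoints : ∀ D N μ → ⟦ E ⟧ₚ D N μ ⇔ (AgreesWithSome (I α) N μ × ⟦ α ⟧ₑ D μ μ)
  E-fixpoints D N μ =
    (AgreesWithSome-absorb (λ z∈ → ∈-∖⁺ z∈ (IODisjoint⇒Disjoint α d z∈)) ×-⇔ ⇔-id (⟦ α ⟧ₑ D μ μ))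
      ⇔-∘ proj₂ compiled D N μ
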